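{- For every finite multiset of formulae $\Gamma$ and formula $\varphi$: the sequent $(\Gamma:\varphi)$ is valid (i.e. $\Gamma\Vdash^{\varnothing}_{\mathcal{B}}\varphi$ for every base $\mathcal{B}$) if and only if $\Gamma\Vdash^{\varnothing}_{\varnothing}\varphi$, where the subscript $\varnothing$ denotes the empty base.
   Context: Fix a set $\mathbb{A}$ of propositional atoms. All multisets are finite; $\uplus$ denotes multiset union; an atomic multiset is a finite multiset of atoms. Formulae: $\varphi ::= p\in\mathbb{A}\mid\top\mid 0\mid 1\mid\varphi\multimap\varphi\mid\varphi\otimes\varphi\mid\varphi\mathbin{\&}\varphi\mid\varphi\oplus\varphi\mid\,!\varphi$. Bases. An atomic sequent is a pair $P\Rightarrow p$ ($P$ atomic multiset, $p$ atom); an atomic box is a finite multiset of atomic sequents; an atomic rule is a triple $\langle\mathbf{A},\mathbf{S},p\rangle$ with $\mathbf{A}$ a finite multiset of atomic boxes, $\mathbf{S}$ an atomic box, $p$ an atom. A base is a set of atomic rules; $\mathcal{C}\supseteq\mathcal{B}$ is set inclusion. An atom $p$ is persistent in $\mathcal{B}$ if $\mathcal{B}$ contains a rule $\langle\varnothing,\mathbf{S},p\rangle$ with $\mathbf{S}\neq\varnothing$. Derivability $P\vdash_{\mathcal{B}}p$ is the smallest relation closed under: (Ref) $\{p\}\vdash_{\mathcal{B}}p$; (App) if $\langle\mathbf{A},\mathbf{S},p\rangle\in\mathcal{B}$ with $\mathbf{A}=\{\mathbf{T}_1,\dots,\mathbf{T}_m\}$, and there are $n\ge m$, atomic multisets $C_1,\dots,C_n$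 and a multiset $D=\{d_{m+1},\dots,d_n\}$ of atoms persistent in $\mathcal{B}$ with $C_i\uplus Q\vdash_{\mathcal{B}}q$ for all $i\le m$ and $Q\Rightarrow q\in\mathbf{T}_i$, $C_j\vdash_{\mathcal{B}}d_j$ for all $m<j\le n$, and $D\uplus U\vdash_{\mathcal{B}}v$ for all $U\Rightarrow v\in\mathbf{S}$, then $C_1\uplus\dots\uplus C_n\vdash_{\mathcal{B}}p$. Support. For a base $\mathcal{B}$, atomic multiset $L$: (At) $\Vdash^L_{\mathcal{B}}p$ iff $L\vdash_{\mathcal{B}}p$; ($\multimap$) $\Vdash^L_{\mathcal{B}}\varphi\multimap\psi$ iff $\varphi\Vdash^L_{\mathcal{B}}\psi$; ($\otimes$) $\Vdash^L_{\mathcal{B}}\varphi\otimes\psi$ iff for all $\mathcal{C}\supseteq\mathcal{B}$, atomic multisets $K$, atoms $p$: if $\{\varphi,\psi\}\Vdash^K_{\mathcal{C}}p$ then $\Vdash^{L\uplus K}_{\mathcal{C}}p$; ($1$) $\Vdash^L_{\mathcal{B}}1$ iff for all $\mathcal{C}\supseteq\mathcal{B}$, $K$, $p$: if $\Vdash^K_{\mathcal{C}}p$ then $\Vdash^{L\uplus K}_{\mathcal{C}}p$; ($\mathbin{\&}$) $\Vdash^L_{\mathcal{B}}\varphi\mathbin{\&}\psi$ iff $\Vdash^L_{\mathcal{B}}\varphi$ and $\Vdash^L_{\mathcal{B}}\psi$; ($\oplus$) $\Vdash^L_{\mathcal{B}}\varphi\oplus\psi$ iff for all $\mathcal{C}\supseteq\mathcal{B}$,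 $K$, $p$: if $\varphi\Vdash^K_{\mathcal{C}}p$ and $\psi\Vdash^K_{\mathcal{C}}p$ then $\Vdash^{L\uplus K}_{\mathcal{C}}p$; ($0$) $\Vdash^L_{\mathcal{B}}0$ iff $\Vdash^{L\uplus K}_{\mathcal{B}}p$ for all atoms $p$ and atomic multisets $K$; ($\top$) $\Vdash^L_{\mathcal{B}}\top$ always; ($!$) $\Vdash^L_{\mathcal{B}}\,!\varphi$ iff for all $\mathcal{C}\supseteq\mathcal{B}$, $K$, $p$: if (for all $\mathcal{D}\supseteq\mathcal{C}$, $\Vdash^{\varnothing}_{\mathcal{D}}\varphi$ implies $\Vdash^K_{\mathcal{D}}p$) then $\Vdash^{L\uplus K}_{\mathcal{C}}p$. Multisets: $\Vdash^L_{\mathcal{B}}\varnothing$ iff $L=\varnothing$; $\Vdash^L_{\mathcal{B}}\{\varphi\}$ iff $\Vdash^L_{\mathcal{B}}\varphi$; $\Vdash^L_{\mathcal{B}}\Gamma\uplus\Delta$ iff $L=K\uplus M$ for some $K,M$ with $\Vdash^K_{\mathcal{B}}\Gamma$, $\Vdash^M_{\mathcal{B}}\Delta$. (Inf) For non-empty $\Gamma$, write $\Gamma=\,!\Delta\uplus\Theta$ with $!\Delta$ the elements whose top-level connective is $!$ and $\Theta$ the rest; $\Gamma\Vdash^L_{\mathcal{B}}\varphi$ iff for all $\mathcal{C}\supseteq\mathcal{B}$ and atomic $K$: if $\Vdash^{\varnothing}_{\mathcal{C}}\delta$ for every $\delta\in\Delta$ and $\Vdash^K_{\mathcal{C}}\Theta$,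 then $\Vdash^{L\uplus K}_{\mathcal{C}}\varphi$. For $\Gamma=\varnothing$, $\Gamma\Vdash^L_{\mathcal{B}}\varphi$ means $\Vdash^L_{\mathcal{B}}\varphi$. -}

module Defs where

open import Level using (Lift; lift) renaming (suc to lsuc; zero to lzero)
open import Data.List using (List; []; _∷_; _++_; concat; map)
open import Data.List.Membership.Propositional using (_∈_)
open import Data.List.Relation.Unary.All using (All)
open import Data.List.Relation.Binary.Pointwise using (Pointwise)
open import Data.List.Relation.Binary.Permutation.Propositional using (_↭_)
open import Data.Product using (Σ; _×_; _,_; proj₁; proj₂)
open import Data.Empty using (⊥)
open import Data.Unit using (⊤)
open import Relation.Binary.PropositionalEquality using (_≡_)
open import Relation.Nullary using (¬_)

-- The set of atoms is an arbitrary type A; multisets are lists up to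
-- permutation (_↭_).

data Formula (A : Set) : Set where
  atom : A → Formula A
  𝟙⊤   : Formula A
  𝟘    : Formula A
  𝟙    : Formula A
  _⊸_  : Formula A → Formula A → Formula A
  _⊗_  : Formula A → Formula A → Formula A
  _&_  : Formula A → Formula A → Formula A
  _⊕_  : Formula A → Formula A → Formula A
  !_   : Formula A → Formula A

module _ {A : Set} where

  ASeq : Set
  ASeq = List A × A

  Box : Set
  Box = List ASeq

  record Rule : Set where
    constructor ⟨_,_,_⟩
    field
      prem   : List Box
      side   : Box
      concl  : A

  Base : Set₁
  Base = Rule → Set

  _⊆B_ : Base → Base → Set
  B ⊆B C = ∀ r → B r → C r

  emptyBase : Base
  emptyBase _ = ⊥

  Persistent : Base → A → Set
  Persistent B p = Σ Box λ S → B ⟨ [] , S , p ⟩ × ¬ (S ≡ [])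

  data Deriv (B : Base) : List A → A → Set where
    ref : ∀ {L p} → L ↭ (p ∷ []) → Deriv B L p
    app : ∀ {As S p L}
        → B ⟨ As , S , p ⟩
        → (Cs : List (List A))
        → Pointwise (λ T C → ∀ {Q q} → (Q , q) ∈ T → Deriv B (C ++ Q) q) As Cs
        → (Ds : List (List A × A))
        → All (λ Cd → Persistent B (proj₂ Cd) × Deriv B (proj₁ Cd) (proj₂ Cd)) Ds
        → (∀ {U v} → (U , v) ∈ S → Deriv B (map proj₂ Ds ++ U) v)
        → L ↭ (concat Cs ++ concat (map proj₁ Ds))
        → Deriv B L p

  Pred : Set₂
  Pred = Base → List A → Set₁

  AtP : A → Pred
  AtP p B L = Lift (lsuc lzero) (Deriv B L p)

  -- entries of a context: formulae of shape !δ (recording δ) and the rest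
  data Entry : Set₂ where
    bang  : Pred → Entry
    plain : Pred → Entry

  bangs : List Entry → List Pred
  bangs []             = []
  bangs (bang P ∷ Γ)   = P ∷ bangs Γ
  bangs (plain _ ∷ Γ)  = bangs Γ

  plains : List Entry → List Pred
  plains []             = []
  plains (bang _ ∷ Γ)   = plains Γ
  plains (plain P ∷ Γ)  = P ∷ plains Γ

  SupM : Base → List A → List Pred → Set₁
  SupM B L []            = Lift (lsuc lzero) (L ≡ [])
  SupM B L (P ∷ [])      = P B L
  SupM B L (P ∷ Q ∷ Ps)  =
    Σ (List A) λ K → Σ (List A) λ M → (L ↭ (K ++ M)) × P B K × SupM B M (Q ∷ Ps)

  AllP : Base → List Pred → Set₁
  AllP C []       = Lift (lsuc lzero) ⊤
  AllP C (P ∷ Ps) = P C [] × AllP C Ps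

  InfE : Base → List A → List Entry → Pred → Set₁
  InfE B L Γ φ = ∀ C → B ⊆B C → ∀ K →
    AllP C (bangs Γ) → SupM C K (plains Γ) → φ C (L ++ K)

  mutual
    ⟦_⟧ : Formula A → Pred
    ⟦ atom p ⟧ B L = AtP p B L
    ⟦ 𝟙⊤ ⟧ B L = Lift (lsuc lzero) ⊤
    ⟦ 𝟘 ⟧ B L = ∀ p K → AtP p B (L ++ K)
    ⟦ 𝟙 ⟧ B L = ∀ C → B ⊆B C → ∀ K p → AtP p C K → AtP p C (L ++ K)
    ⟦ φ ⊸ ψ ⟧ B L = InfE B L (entry φ ∷ []) ⟦ ψ ⟧
    ⟦ φ ⊗ ψ ⟧ B L = ∀ C → B ⊆B C → ∀ K p →
      InfE C K (entry φ ∷ entry ψ ∷ []) (AtP p) → AtP p C (L ++ K)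
    ⟦ φ & ψ ⟧ B L = ⟦ φ ⟧ B L × ⟦ ψ ⟧ B L
    ⟦ φ ⊕ ψ ⟧ B L = ∀ C → B ⊆B C → ∀ K p →
      InfE C K (entry φ ∷ []) (AtP p) → InfE C K (entry ψ ∷ []) (AtP p) →
      AtP p C (L ++ K)
    ⟦ ! φ ⟧ B L = ∀ C → B ⊆B C → ∀ K p →
      (∀ D → C ⊆B D → ⟦ φ ⟧ D [] → AtP p D K) → AtP p C (L ++ K)

    entry : Formula A → Entry
    entry (! φ)     = bang ⟦ φ ⟧
    entry (atom p)  = plain ⟦ atom p ⟧
    entry 𝟙⊤        = plain ⟦ 𝟙⊤ ⟧
    entry 𝟘         = plain ⟦ 𝟘 ⟧
    entry 𝟙         = plain ⟦ 𝟙 ⟧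
    entry (φ ⊸ ψ)   = plain ⟦ φ ⊸ ψ ⟧
    entry (φ ⊗ ψ)   = plain ⟦ φ ⊗ ψ ⟧
    entry (φ & ψ)   = plain ⟦ φ & ψ ⟧
    entry (φ ⊕ ψ)   = plain ⟦ φ ⊕ ψ ⟧

  _⊩[_]_⦂_ : List (Formula A) → Base → List A → Formula A → Set₁
  [] ⊩[ B ] L ⦂ φ = ⟦ φ ⟧ B L
  (γ ∷ Γ) ⊩[ B ] L ⦂ φ = InfE B L (map entry (γ ∷ Γ)) ⟦ φ ⟧

  Valid : List (Formula A) → Formula A → Set₁
  Valid Γ φ = ∀ (B : Base) → Γ ⊩[ B ] [] ⦂ φ

{-# OPTIONS --safe #-}
-- Support is monotone under extension of the base: atomic derivations
-- survive the addition of rules, and every other clause already quantifies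
-- over all extensions.  The empty base is contained in every base, so support
-- in the empty base yields support everywhere.
module Submission where

open import Defs
open import Data.List using (List; []; _∷_; _++_; map)
open import Data.Product using (_×_; _,_; proj₁; proj₂)
open import Level using (lift; lower)
open import Data.List.Relation.Binary.Pointwise using (Pointwise; []; _∷_)
open import Data.List.Relation.Unary.All using (All; []; _∷_)
open import Data.List.Membership.Propositional using (_∈_)

module _ {A : Set} where

  ⊆B-trans : {B C D : Base {A}} → B ⊆B C → C ⊆B D → B ⊆B D
  ⊆B-trans B⊆C C⊆D r r∈B = C⊆D r (B⊆C r r∈B)

  emptyBase-⊆B : (B : Base {A}) → emptyBase ⊆B B
  emptyBase-⊆B B r ()

  mutual
    Deriv-mono : {B C : Base {A}} → B ⊆B C → ∀ {L p} → Deriv B L p → Deriv C L p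
    Deriv-mono B⊆C (ref L↭p) = ref L↭p
    Deriv-mono B⊆C (app r Cs prems Ds persistents side L↭) =
      app (B⊆C _ r) Cs (premises-mono B⊆C prems) Ds (persistents-mono B⊆C persistents)
          (λ U⇒v∈S → Deriv-mono B⊆C (side U⇒v∈S)) L↭

    premises-mono : {B C : Base {A}} → B ⊆B C → ∀ {As Cs} →
      Pointwise (λ T D → ∀ {Q q} → (Q , q) ∈ T → Deriv B (D ++ Q) q) As Cs →
      Pointwise (λ T D → ∀ {Q q} → (Q , q) ∈ T → Deriv C (D ++ Q) q) As Cs
    premises-mono B⊆C [] = []
    premises-mono B⊆C (prem ∷ prems) =
      (λ Q⇒q∈T → Deriv-mono B⊆C (prem Q⇒q∈T)) ∷ premises-mono B⊆C prems

    persistents-mono : {B C : Base {A}} → B ⊆B C → ∀ {Ds} →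
      All (λ Cd → Persistent B (proj₂ Cd) × Deriv B (proj₁ Cd) (proj₂ Cd)) Ds →
      All (λ Cd → Persistent C (proj₂ Cd) × Deriv C (proj₁ Cd) (proj₂ Cd)) Ds
    persistents-mono B⊆C [] = []
    persistents-mono B⊆C (((S , r , S≢[]) , d) ∷ rest) =
      ((S , B⊆C _ r , S≢[]) , Deriv-mono B⊆C d) ∷ persistents-mono B⊆C rest

  InfE-mono : {B C : Base {A}} → B ⊆B C → ∀ {L Γ P} → InfE B L Γ P → InfE C L Γ P
  InfE-mono B⊆C h D C⊆D = h D (⊆B-trans B⊆C C⊆D)

  ⟦⟧-mono : (φ : Formula A) → {B C : Base {A}} → B ⊆B C → ∀ {L} → ⟦ φ ⟧ B L → ⟦ φ ⟧ C L
  ⟦⟧-mono (atom p)  B⊆C h         = lift (Deriv-mono B⊆C (lower h))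
  ⟦⟧-mono 𝟙⊤        B⊆C h         = h
  ⟦⟧-mono 𝟘         B⊆C h         = λ p K → lift (Deriv-mono B⊆C (lower (h p K)))
  ⟦⟧-mono 𝟙         B⊆C h         = λ D C⊆D → h D (⊆B-trans B⊆C C⊆D)
  ⟦⟧-mono (φ ⊸ ψ)   B⊆C h         =
    InfE-mono B⊆C {Γ = entry φ ∷ []} {P = ⟦ ψ ⟧} h
  ⟦⟧-mono (φ ⊗ ψ)   B⊆C h         = λ D C⊆D → h D (⊆B-trans B⊆C C⊆D)
  ⟦⟧-mono (φ & ψ)   B⊆C (hφ , hψ) = ⟦⟧-mono φ B⊆C hφ , ⟦⟧-mono ψ B⊆C hψ
  ⟦⟧-mono (φ ⊕ ψ)   B⊆C h         = λ D C⊆D → h D (⊆B-trans B⊆C C⊆D)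
  ⟦⟧-mono (! φ)     B⊆C h         = λ D C⊆D → h D (⊆B-trans B⊆C C⊆D)

  ⊩-mono : (Γ : List (Formula A)) (φ : Formula A) → {B C : Base {A}} → B ⊆B C →
    ∀ {L} → Γ ⊩[ B ] L ⦂ φ → Γ ⊩[ C ] L ⦂ φ
  ⊩-mono []      φ B⊆C h = ⟦⟧-mono φ B⊆C h
  ⊩-mono (γ ∷ Γ) φ B⊆C h = InfE-mono B⊆C {Γ = map entry (γ ∷ Γ)} {P = ⟦ φ ⟧} h

mainTheorem8 : {A : Set} (Γ : List (Formula A)) (φ : Formula A) →
    (Valid Γ φ → Γ ⊩[ emptyBase ] [] ⦂ φ) × (Γ ⊩[ emptyBase ] [] ⦂ φ → Valid Γ φ)
mainTheorem8 Γ φ =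
  (λ valid → valid emptyBase) ,
  (λ h B → ⊩-mono Γ φ (emptyBase-⊆B B) h)
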